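{- Let $G$ be a finite simple graph with $m$ edges and minimum degree $\delta(G)$, and let $\kappa:V(G)\to\mathbb{N}$ be a positive integer valued function. Set $\alpha=\max\{\deg_G(v)-\kappa(v): v\in V(G)\}$ and $\beta=\min\{\deg_G(v)-\kappa(v): v\in V(G)\}$, and assume $\beta>0$. Then every induced subgraph $H$ of $G$ that is $\kappa$-degenerate (with respect to the restriction of $\kappa$ to $V(H)$) satisfies $$|V(H)|\le \frac{m-\delta(G)+\alpha}{\beta}.$$
   Context: For a graph $H$ and a function $\kappa: V(H)\to\mathbb{N}\cup\{0\}$, $H$ is called $\kappa$-degenerate if its vertices can be ordered $v_1,\dots,v_h$ so that for every $i$, the degree of $v_i$ in the subgraph of $H$ induced by $\{v_1,\dots,v_i\}$ is at most $\kappa(v_i)$. -}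

module Defs where

open import Data.Nat using (ℕ; zero; suc; _+_; _≤_; _<ᵇ_)
open import Data.Nat as ℕ using ()
open import Data.Integer as ℤ using (ℤ; _⊔_; _⊓_)
open import Data.Bool using (Bool; true; false; if_then_else_; _∧_)
open import Data.Fin using (Fin; toℕ)
open import Data.Fin.Subset using (Subset)
open import Data.List using (List; []; _∷_; take; length; lookup; map; allFin)
open import Data.Nat.ListAction using (sum)
open import Data.List.Relation.Unary.Unique.Propositional using (Unique)
open import Data.List.Membership.Propositional using (_∈_)
open import Data.Product using (Σ; _×_; ∃)
open import Function.Bundles using (_⇔_)
open import Relation.Binary.PropositionalEquality using (_≡_)
import Data.Fin.Subset as Sub

record Graph (n : ℕ) : Set where
  field
    adj   : Fin n → Fin n → Bool
    sym   : ∀ u v → adj u v ≡ adj v u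
    irrefl : ∀ v → adj v v ≡ false
open Graph public

countB : ∀ {A : Set} → (A → Bool) → List A → ℕ
countB p []       = 0
countB p (x ∷ xs) = (if p x then 1 else 0) + countB p xs

deg : ∀ {n} → Graph n → Fin n → ℕ
deg G v = countB (adj G v) (allFin _)

edges : ∀ {n} → Graph n → ℕ
edges {n} G = sum (map (λ i → countB (λ j → (toℕ i <ᵇ toℕ j) ∧ adj G i j) (allFin n)) (allFin n))

maxℤ : ∀ {k} → (Fin (suc k) → ℤ) → ℤ
maxℤ {zero}  f = f Fin.zero
  where import Data.Fin as Fin
maxℤ {suc k} f = f Fin.zero ⊔ maxℤ (λ i → f (Fin.suc i))
  where import Data.Fin as Fin

minℤ : ∀ {k} → (Fin (suc k) → ℤ) → ℤ
minℤ {zero}  f = f Fin.zero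
  where import Data.Fin as Fin
minℤ {suc k} f = f Fin.zero ⊓ minℤ (λ i → f (Fin.suc i))
  where import Data.Fin as Fin

minℕ : ∀ {k} → (Fin (suc k) → ℕ) → ℕ
minℕ {zero}  f = f Fin.zero
  where import Data.Fin as Fin
minℕ {suc k} f = f Fin.zero ℕ.⊓ minℕ (λ i → f (Fin.suc i))
  where import Data.Fin as Fin

δ : ∀ {k} → Graph (suc k) → ℕ
δ G = minℕ (deg G)

excess : ∀ {n} → Graph n → (Fin n → ℕ) → Fin n → ℤ
excess G κ v = ℤ.+ deg G v ℤ.- ℤ.+ κ v

-- The induced subgraph G[S] is κ-degenerate: there is an ordering v_1,…,v_h
-- of S (a duplicate-free list with the same elements as S) such that every
-- v_i has at most κ(v_i) neighbours among v_1,…,v_{i-1}, i.e. its degree in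
-- the subgraph induced by {v_1,…,v_i} is at most κ(v_i).
IsOrderingOf : ∀ {n} → List (Fin n) → Subset n → Set
IsOrderingOf vs S = Unique vs × (∀ v → (v ∈ vs) ⇔ (v Sub.∈ S))

DegenerateOrdering : ∀ {n} → Graph n → (Fin n → ℕ) → List (Fin n) → Set
DegenerateOrdering G κ vs =
  ∀ (i : Fin (length vs)) →
    countB (adj G (lookup vs i)) (take (toℕ i) vs) ≤ κ (lookup vs i)

InducedDegenerate : ∀ {n} → Graph n → (Fin n → ℕ) → Subset n → Set
InducedDegenerate G κ S =
  Σ (List (Fin _)) λ vs → IsOrderingOf vs S × DegenerateOrdering G κ vs

-- Order the vertices of H as v₁, …, v_h so that each v_i has at most κ(v_i) neighbours among
-- v₁, …, v_{i-1}.  Adding v_i to {v₁, …, v_{i-1}} raises the number of edges of G touching the set by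
-- deg v_i minus its number of earlier neighbours, hence by at least deg v_i − κ(v_i) ≥ β when i > 1,
-- and by exactly deg v₁ ≥ δ(G) when i = 1.  The final count is at most m, so δ(G) + β (h − 1) ≤ m,
-- and β ≤ α gives the bound.
module Submission where

open import Data.Bool using (Bool; true; false; if_then_else_; _∧_; _∨_; not)
open import Data.Bool.Properties using (∧-zeroʳ; ∧-identityʳ)
open import Data.Fin using (Fin; toℕ; zero; suc)
open import Data.Fin.Properties using (_≟_; toℕ-injective)
open import Data.Fin.Subset using (Subset; ∣_∣)
import Data.Fin.Subset as Subset
open import Data.Integer as ℤ using (ℤ; +_; _-_; +≤+)
import Data.Integer.Properties as ℤ
open import Data.Integer.Solver using (module +-*-Solver)
open import Data.List using (List; []; _∷_; length; lookup; take; map; tabulate; allFin)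
open import Data.List.Membership.Propositional using (_∈_; _∉_)
open import Data.List.Relation.Unary.All using (All; []; _∷_)
import Data.List.Relation.Unary.All as All
open import Data.List.Relation.Unary.All.Properties using (¬Any⇒All¬; All¬⇒¬Any)
open import Data.List.Relation.Unary.Any using (here; there; any?)
open import Data.List.Relation.Unary.Unique.Propositional using (Unique; []; _∷_)
open import Data.Nat using (ℕ; zero; suc; _+_; _*_; _∸_; _≤_; _<ᵇ_; z≤n)
open import Data.Nat.ListAction using (sum)
open import Data.Nat.Properties
  using (+-0-commutativeMonoid; +-commutativeSemigroup; +-mono-≤; +-monoʳ-≤; +-monoˡ-≤; +-assoc; +-comm;
         +-identityʳ; +-cancelʳ-≤; ∸-monoʳ-≤; m+n≤o⇒m≤o∸n; ≤-refl; ≤-reflexive; ≤-trans; *-zeroʳ; *-suc;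
         m⊓n≤m; m⊓n≤n; module ≤-Reasoning)
open import Data.Product using (_,_; uncurry)
open import Data.Vec using ([]; _∷_)
import Data.Vec as Vec
open import Data.Vec.Properties using ([]=⇒lookup; lookup⇒[]=)
open import Defs hiding (sym)
open import Function using (_∘_; id)
open import Function.Bundles using (_⇔_; Equivalence)
open import Relation.Binary.PropositionalEquality
  using (_≡_; _≢_; refl; sym; trans; cong; cong₂; subst; subst₂; module ≡-Reasoning)
open import Relation.Nullary using (does; yes; no; contradiction)
open import Relation.Nullary.Decidable using (dec-false)

open import Algebra.Properties.CommutativeMonoid.Sum +-0-commutativeMonoid
  using (sum-syntax; sum-cong-≗; ∑-distrib-+; ∑-comm; sum-replicate-zero)
  renaming (sum to ∑)
open import Algebra.Properties.CommutativeSemigroup +-commutativeSemigroup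
  using (interchange; xy∙z≈xz∙y; xy∙z≈x∙zy; xy∙z≈y∙zx; x∙yz≈yx∙z)

⟦_⟧ : Bool → ℕ
⟦ b ⟧ = if b then 1 else 0

∑-mono-≤ : ∀ {n} {f g : Fin n → ℕ} → (∀ i → f i ≤ g i) → ∑ f ≤ ∑ g
∑-mono-≤ {zero}  f≤g = z≤n
∑-mono-≤ {suc n} f≤g = +-mono-≤ (f≤g zero) (∑-mono-≤ (λ i → f≤g (suc i)))

∑-zero : ∀ {n} {f : Fin n → ℕ} → (∀ i → f i ≡ 0) → ∑ f ≡ 0
∑-zero {n} f≡0 = trans (sum-cong-≗ f≡0) (sum-replicate-zero n)

∑-select : ∀ {n} (v : Fin n) (f : Fin n → ℕ) → ∑[ u < n ] (if does (u ≟ v) then f u else 0) ≡ f v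
∑-select {suc n} zero    f = trans (cong (_+_ (f zero)) (sum-replicate-zero n)) (+-identityʳ _)
∑-select {suc n} (suc v) f = ∑-select v (λ u → f (suc u))

∑∑-distrib-+ : ∀ {n} (f g : Fin n → Fin n → ℕ) →
  ∑[ i < n ] ∑[ j < n ] (f i j + g i j) ≡ ∑[ i < n ] ∑[ j < n ] f i j + ∑[ i < n ] ∑[ j < n ] g i j
∑∑-distrib-+ f g = trans (sum-cong-≗ (λ i → ∑-distrib-+ (f i) (g i)))
                         (∑-distrib-+ (λ i → ∑ (f i)) (λ i → ∑ (g i)))

countB-tabulate : ∀ {A : Set} {n} (p : A → Bool) (f : Fin n → A) →
  countB p (tabulate f) ≡ ∑[ i < n ] ⟦ p (f i) ⟧
countB-tabulate {n = zero}  p f = refl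
countB-tabulate {n = suc n} p f = cong (_+_ ⟦ p (f zero) ⟧) (countB-tabulate p (λ i → f (suc i)))

sum-map-tabulate : ∀ {A : Set} {n} (g : A → ℕ) (f : Fin n → A) →
  sum (map g (tabulate f)) ≡ ∑[ i < n ] g (f i)
sum-map-tabulate {n = zero}  g f = refl
sum-map-tabulate {n = suc n} g f = cong (_+_ (g (f zero))) (sum-map-tabulate g (λ i → f (suc i)))

sum[f]+b*length≤sum[g] : ∀ {A : Set} {f g : A → ℕ} {b} → (∀ x → f x + b ≤ g x) →
  ∀ xs → sum (map f xs) + b * length xs ≤ sum (map g xs)
sum[f]+b*length≤sum[g] {b = b} f+b≤g []       = ≤-reflexive (*-zeroʳ b)
sum[f]+b*length≤sum[g] {f = f} {g} {b} f+b≤g (x ∷ xs) = begin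
  (f x + F) + b * suc (length xs) ≡⟨ cong (_+_ (f x + F)) (*-suc b (length xs)) ⟩
  (f x + F) + (b + b * length xs) ≡⟨ interchange (f x) F b (b * length xs) ⟩
  (f x + b) + (F + b * length xs) ≤⟨ +-mono-≤ (f+b≤g x) (sum[f]+b*length≤sum[g] f+b≤g xs) ⟩
  g x + sum (map g xs)            ∎
  where
  open ≤-Reasoning
  F = sum (map f xs)

⟦∧∨⟧-disjoint : ∀ p e m → (e ≡ true → m ≡ false) → ⟦ p ∧ (e ∨ m) ⟧ ≡ (if e then ⟦ p ⟧ else 0) + ⟦ p ∧ m ⟧
⟦∧∨⟧-disjoint false true  m     _ = refl
⟦∧∨⟧-disjoint false false m     _ = refl
⟦∧∨⟧-disjoint true  true  true  h with () ← h refl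
⟦∧∨⟧-disjoint true  true  false _ = refl
⟦∧∨⟧-disjoint true  false m     _ = refl

⟦∧∧⟧≤⟦∧⟧ : ∀ x y z → ⟦ x ∧ y ∧ z ⟧ ≤ ⟦ x ∧ y ⟧
⟦∧∧⟧≤⟦∧⟧ false y     z     = z≤n
⟦∧∧⟧≤⟦∧⟧ true  false z     = z≤n
⟦∧∧⟧≤⟦∧⟧ true  true  false = z≤n
⟦∧∧⟧≤⟦∧⟧ true  true  true  = ≤-refl

⟦⟧-split : ∀ x s → ⟦ x ⟧ ≡ ⟦ x ∧ s ⟧ + ⟦ x ∧ not s ⟧
⟦⟧-split false s     = refl
⟦⟧-split true  true  = refl
⟦⟧-split true  false = refl

⟦⟧-either-order : ∀ x y b c → (b ≡ true → x ≡ not y) → ⟦ x ∧ b ∧ c ⟧ + ⟦ y ∧ b ∧ c ⟧ ≡ ⟦ b ∧ c ⟧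
⟦⟧-either-order false false false c     _ = refl
⟦⟧-either-order false true  false c     _ = refl
⟦⟧-either-order true  false false c     _ = refl
⟦⟧-either-order true  true  false c     _ = refl
⟦⟧-either-order true  true  true  c     h with () ← h refl
⟦⟧-either-order false false true  c     h with () ← h refl
⟦⟧-either-order true  false true  true  _ = refl
⟦⟧-either-order true  false true  false _ = refl
⟦⟧-either-order false true  true  true  _ = refl
⟦⟧-either-order false true  true  false _ = refl

-- An edge touches s ∪ {v} iff it touches s, or v is one endpoint and the other lies outside s.
⟦⟧-insert : ∀ l x si sj ei ej → (ei ≡ true → si ≡ false) → (ej ≡ true → sj ≡ false) →
  (ei ≡ true → ej ≡ true → l ≡ false) →
  ⟦ l ∧ x ∧ ((ei ∨ si) ∨ (ej ∨ sj)) ⟧ ≡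
    (if ei then ⟦ l ∧ x ∧ not sj ⟧ else 0) + (if ej then ⟦ l ∧ x ∧ not si ⟧ else 0) + ⟦ l ∧ x ∧ (si ∨ sj) ⟧
⟦⟧-insert l     x     si    sj    false false _  _  _ = refl
⟦⟧-insert l     x     true  sj    true  ej    hi _  _ with () ← hi refl
⟦⟧-insert l     x     si    true  ei    true  _  hj _ with () ← hj refl
⟦⟧-insert true  x     false false true  true  _  _  h with () ← h refl refl
⟦⟧-insert false x     false false true  true  _  _  _ = refl
⟦⟧-insert false x     false sj    true  false _  _  _ = refl
⟦⟧-insert true  false false sj    true  false _  _  _ = refl
⟦⟧-insert true  true  false true  true  false _  _  _ = refl
⟦⟧-insert true  true  false false true  false _  _  _ = refl
⟦⟧-insert false x     si    false false true  _  _  _ = refl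
⟦⟧-insert true  false si    false false true  _  _  _ = refl
⟦⟧-insert true  true  true  false false true  _  _  _ = refl
⟦⟧-insert true  true  false false false true  _  _  _ = refl

<ᵇ-irrefl : ∀ n → (n <ᵇ n) ≡ false
<ᵇ-irrefl zero    = refl
<ᵇ-irrefl (suc n) = <ᵇ-irrefl n

<ᵇ-≢ : ∀ {m n} → m ≢ n → (m <ᵇ n) ≡ not (n <ᵇ m)
<ᵇ-≢ {zero}  {zero}  m≢n = contradiction refl m≢n
<ᵇ-≢ {zero}  {suc n} m≢n = refl
<ᵇ-≢ {suc m} {zero}  m≢n = refl
<ᵇ-≢ {suc m} {suc n} m≢n = <ᵇ-≢ (λ m≡n → m≢n (cong suc m≡n))

does-≟⇒≡ : ∀ {n} {i j : Fin n} → does (i ≟ j) ≡ true → i ≡ j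
does-≟⇒≡ {i = i} {j} e with i ≟ j
... | yes i≡j = i≡j
does-≟⇒≡ () | no _

∉-∷ : ∀ {A : Set} {x y : A} {xs} → x ≢ y → y ∉ xs → y ∉ x ∷ xs
∉-∷ x≢y y∉xs (here y≡x)   = x≢y (sym y≡x)
∉-∷ x≢y y∉xs (there y∈xs) = y∉xs y∈xs

mem : ∀ {n} → List (Fin n) → Fin n → Bool
mem xs u = does (any? (u ≟_) xs)

∑-mem≡countB : ∀ {n} (p : Fin n → Bool) {xs} → Unique xs → ∑[ u < n ] ⟦ p u ∧ mem xs u ⟧ ≡ countB p xs
∑-mem≡countB p []             = ∑-zero (λ u → cong ⟦_⟧ (∧-zeroʳ (p u)))
∑-mem≡countB {n} p {x ∷ xs} (x∉xs ∷ xs!) = begin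
  ∑[ u < n ] ⟦ p u ∧ mem (x ∷ xs) u ⟧
    ≡⟨ sum-cong-≗ (λ u → ⟦∧∨⟧-disjoint (p u) (does (u ≟ x)) (mem xs u) (fresh u)) ⟩
  ∑[ u < n ] ((if does (u ≟ x) then ⟦ p u ⟧ else 0) + ⟦ p u ∧ mem xs u ⟧)
    ≡⟨ ∑-distrib-+ (λ u → if does (u ≟ x) then ⟦ p u ⟧ else 0) (λ u → ⟦ p u ∧ mem xs u ⟧) ⟩
  ∑[ u < n ] (if does (u ≟ x) then ⟦ p u ⟧ else 0) + ∑[ u < n ] ⟦ p u ∧ mem xs u ⟧
    ≡⟨ cong₂ _+_ (∑-select x (λ u → ⟦ p u ⟧)) (∑-mem≡countB p xs!) ⟩
  ⟦ p x ⟧ + countB p xs ∎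
  where
  open ≡-Reasoning
  fresh : ∀ u → does (u ≟ x) ≡ true → mem xs u ≡ false
  fresh u e with u ≟ x
  ... | yes refl = dec-false (any? (x ≟_) xs) (All¬⇒¬Any x∉xs)
  fresh u () | no _

countB-const-true : ∀ {A : Set} (xs : List A) → countB (λ _ → true) xs ≡ length xs
countB-const-true []       = refl
countB-const-true (x ∷ xs) = cong suc (countB-const-true xs)

∣∣-∑ : ∀ {n} (S : Subset n) → ∣ S ∣ ≡ ∑[ u < n ] ⟦ Vec.lookup S u ⟧
∣∣-∑ []          = refl
∣∣-∑ (true ∷ S)  = cong suc (∣∣-∑ S)
∣∣-∑ (false ∷ S) = ∣∣-∑ S

∣∣≡length : ∀ {n} {S : Subset n} {vs} → Unique vs → (∀ v → (v ∈ vs) ⇔ (v Subset.∈ S)) → ∣ S ∣ ≡ length vs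
∣∣≡length {n} {S} {vs} vs! vs≈S = begin
  ∣ S ∣                               ≡⟨ ∣∣-∑ S ⟩
  ∑[ u < n ] ⟦ Vec.lookup S u ⟧       ≡⟨ sum-cong-≗ same-indicator ⟩
  ∑[ u < n ] ⟦ mem vs u ⟧             ≡⟨ ∑-mem≡countB (λ _ → true) vs! ⟩
  countB (λ _ → true) vs              ≡⟨ countB-const-true vs ⟩
  length vs                           ∎
  where
  open ≡-Reasoning
  same-indicator : ∀ u → ⟦ Vec.lookup S u ⟧ ≡ ⟦ mem vs u ⟧
  same-indicator u with any? (u ≟_) vs
  ... | yes u∈vs = cong ⟦_⟧ ([]=⇒lookup (Equivalence.to (vs≈S u) u∈vs))
  ... | no u∉vs with Vec.lookup S u in u∈S
  ...   | false = refl
  ...   | true  = contradiction (Equivalence.from (vs≈S u) (lookup⇒[]= u S u∈S)) u∉vs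

module _ {n} (G : Graph n) where

  _≺_ : Fin n → Fin n → Bool
  i ≺ j = toℕ i <ᵇ toℕ j

  insert : Fin n → (Fin n → Bool) → Fin n → Bool
  insert v s u = does (u ≟ v) ∨ s u

  edgesTouching : (Fin n → Bool) → ℕ
  edgesTouching s = ∑[ i < n ] ∑[ j < n ] ⟦ i ≺ j ∧ adj G i j ∧ (s i ∨ s j) ⟧

  degreeInto : Fin n → (Fin n → Bool) → ℕ
  degreeInto v s = ∑[ u < n ] ⟦ adj G v u ∧ s u ⟧

  edges-∑ : edges G ≡ ∑[ i < n ] ∑[ j < n ] ⟦ i ≺ j ∧ adj G i j ⟧
  edges-∑ = trans (sum-map-tabulate (λ i → countB (λ j → i ≺ j ∧ adj G i j) (allFin n)) id)
                  (sum-cong-≗ (λ i → countB-tabulate (λ j → i ≺ j ∧ adj G i j) id))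

  deg-∑ : ∀ v → deg G v ≡ ∑[ u < n ] ⟦ adj G v u ⟧
  deg-∑ v = countB-tabulate (adj G v) id

  edgesTouching≤edges : ∀ s → edgesTouching s ≤ edges G
  edgesTouching≤edges s = subst (edgesTouching s ≤_) (sym edges-∑)
    (∑-mono-≤ (λ i → ∑-mono-≤ (λ j → ⟦∧∧⟧≤⟦∧⟧ (i ≺ j) (adj G i j) _)))

  deg-split : ∀ v s → deg G v ≡ degreeInto v s + degreeInto v (not ∘ s)
  deg-split v s = trans (deg-∑ v) (trans (sum-cong-≗ (λ u → ⟦⟧-split (adj G v u) (s u)))
                                         (∑-distrib-+ (λ u → ⟦ adj G v u ∧ s u ⟧) (λ u → ⟦ adj G v u ∧ not (s u) ⟧)))

  adjacent⇒toℕ-≢ : ∀ {v u} → adj G v u ≡ true → toℕ v ≢ toℕ u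
  adjacent⇒toℕ-≢ {v} vu v≡u with refl ← toℕ-injective v≡u with () ← trans (sym vu) (irrefl G v)

  degreeInto-by-order : ∀ v t →
    ∑[ u < n ] ⟦ v ≺ u ∧ adj G v u ∧ t u ⟧ + ∑[ u < n ] ⟦ u ≺ v ∧ adj G u v ∧ t u ⟧ ≡ degreeInto v t
  degreeInto-by-order v t =
    trans (sym (∑-distrib-+ (λ u → ⟦ v ≺ u ∧ adj G v u ∧ t u ⟧) (λ u → ⟦ u ≺ v ∧ adj G u v ∧ t u ⟧)))
          (sum-cong-≗ either-order)
    where
    either-order : ∀ u → ⟦ v ≺ u ∧ adj G v u ∧ t u ⟧ + ⟦ u ≺ v ∧ adj G u v ∧ t u ⟧ ≡ ⟦ adj G v u ∧ t u ⟧
    either-order u rewrite Graph.sym G u v =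
      ⟦⟧-either-order (v ≺ u) (u ≺ v) (adj G v u) (t u) (λ vu → <ᵇ-≢ (adjacent⇒toℕ-≢ vu))

  edgesTouching-insert : ∀ v s → s v ≡ false →
    edgesTouching (insert v s) ≡ degreeInto v (not ∘ s) + edgesTouching s
  edgesTouching-insert v s sv≡false = begin
    edgesTouching (insert v s)
      ≡⟨ sum-cong-≗ (λ i → sum-cong-≗ (λ j → ⟦⟧-insert (i ≺ j) (adj G i j) (s i) (s j)
           (does (i ≟ v)) (does (j ≟ v)) (fresh i) (fresh j) (not-both i j))) ⟩
    ∑[ i < n ] ∑[ j < n ] (out i j + into i j + inside i j)
      ≡⟨ trans (∑∑-distrib-+ (λ i j → out i j + into i j) inside)
               (cong (_+ edgesTouching s) (∑∑-distrib-+ out into)) ⟩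
    ∑[ i < n ] ∑[ j < n ] out i j + ∑[ i < n ] ∑[ j < n ] into i j + edgesTouching s
      ≡⟨ cong (λ k → k + edgesTouching s) (cong₂ _+_
           (trans (∑-comm out) (sum-cong-≗ (λ j → ∑-select v (λ i → ⟦ i ≺ j ∧ adj G i j ∧ not (s j) ⟧))))
           (sum-cong-≗ (λ i → ∑-select v (λ j → ⟦ i ≺ j ∧ adj G i j ∧ not (s i) ⟧)))) ⟩
    ∑[ u < n ] ⟦ v ≺ u ∧ adj G v u ∧ not (s u) ⟧ + ∑[ u < n ] ⟦ u ≺ v ∧ adj G u v ∧ not (s u) ⟧
      + edgesTouching s
      ≡⟨ cong (_+ edgesTouching s) (degreeInto-by-order v (not ∘ s)) ⟩
    degreeInto v (not ∘ s) + edgesTouching s ∎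
    where
    open ≡-Reasoning
    out into inside : Fin n → Fin n → ℕ
    out    i j = if does (i ≟ v) then ⟦ i ≺ j ∧ adj G i j ∧ not (s j) ⟧ else 0
    into   i j = if does (j ≟ v) then ⟦ i ≺ j ∧ adj G i j ∧ not (s i) ⟧ else 0
    inside i j = ⟦ i ≺ j ∧ adj G i j ∧ (s i ∨ s j) ⟧
    fresh : ∀ i → does (i ≟ v) ≡ true → s i ≡ false
    fresh i e with refl ← does-≟⇒≡ {i = i} {v} e = sv≡false
    not-both : ∀ i j → does (i ≟ v) ≡ true → does (j ≟ v) ≡ true → (i ≺ j) ≡ false
    not-both i j ei ej with refl ← does-≟⇒≡ {i = i} {v} ei with refl ← does-≟⇒≡ {i = j} {i} ej = <ᵇ-irrefl (toℕ i)

  edgesTouching-insert+degreeInto : ∀ v s → s v ≡ false →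
    edgesTouching (insert v s) + degreeInto v s ≡ edgesTouching s + deg G v
  edgesTouching-insert+degreeInto v s sv≡false = begin
    edgesTouching (insert v s) + degreeInto v s
      ≡⟨ cong (_+ degreeInto v s) (edgesTouching-insert v s sv≡false) ⟩
    degreeInto v (not ∘ s) + edgesTouching s + degreeInto v s
      ≡⟨ xy∙z≈y∙zx (degreeInto v (not ∘ s)) (edgesTouching s) (degreeInto v s) ⟩
    edgesTouching s + (degreeInto v s + degreeInto v (not ∘ s))
      ≡⟨ cong (_+_ (edgesTouching s)) (sym (deg-split v s)) ⟩
    edgesTouching s + deg G v ∎
    where open ≡-Reasoning

  ∅ : Fin n → Bool
  ∅ _ = false

  edgesTouching-∅ : edgesTouching ∅ ≡ 0
  edgesTouching-∅ = ∑-zero (λ i → ∑-zero (λ j →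
    cong ⟦_⟧ (trans (cong (i ≺ j ∧_) (∧-zeroʳ (adj G i j))) (∧-zeroʳ (i ≺ j)))))

  edgesTouching-singleton : ∀ v → edgesTouching (insert v ∅) ≡ deg G v
  edgesTouching-singleton v = begin
    edgesTouching (insert v ∅)          ≡⟨ edgesTouching-insert v ∅ refl ⟩
    degreeInto v (not ∘ ∅) + edgesTouching ∅
      ≡⟨ cong₂ _+_ (sum-cong-≗ (λ u → cong ⟦_⟧ (∧-identityʳ (adj G v u)))) edgesTouching-∅ ⟩
    ∑[ u < n ] ⟦ adj G v u ⟧ + 0        ≡⟨ +-identityʳ _ ⟩
    ∑[ u < n ] ⟦ adj G v u ⟧            ≡⟨ sym (deg-∑ v) ⟩
    deg G v                             ∎
    where open ≡-Reasoning

  deg≤edges : ∀ v → deg G v ≤ edges G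
  deg≤edges v = subst (_≤ edges G) (edgesTouching-singleton v) (edgesTouching≤edges (insert v ∅))

  module _ (κ : Fin n → ℕ) where

    -- A κ-degenerate ordering of vs continuing one that has already placed the vertex set s; this is
    -- the form of DegenerateOrdering that supports induction along the list.
    data DegenerateExtension (s : Fin n → Bool) : List (Fin n) → Set where
      []     : DegenerateExtension s []
      extend : ∀ {x xs} → s x ≡ false → degreeInto x s ≤ κ x →
               DegenerateExtension (insert x s) xs → DegenerateExtension s (x ∷ xs)

    edgesTouching+∑deg≤edges+∑κ : ∀ {s vs} → DegenerateExtension s vs →
      edgesTouching s + sum (map (deg G) vs) ≤ edges G + sum (map κ vs)
    edgesTouching+∑deg≤edges+∑κ {s = s} [] = +-monoˡ-≤ 0 (edgesTouching≤edges s)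
    edgesTouching+∑deg≤edges+∑κ {s} {x ∷ xs} (extend sx≡false back≤κ ext) = begin
      edgesTouching s + (deg G x + D)                    ≡⟨ sym (+-assoc _ (deg G x) D) ⟩
      edgesTouching s + deg G x + D                      ≡⟨ cong (_+ D) (sym (edgesTouching-insert+degreeInto x s sx≡false)) ⟩
      edgesTouching (insert x s) + degreeInto x s + D    ≡⟨ xy∙z≈xz∙y _ (degreeInto x s) D ⟩
      edgesTouching (insert x s) + D + degreeInto x s    ≤⟨ +-mono-≤ (edgesTouching+∑deg≤edges+∑κ ext) back≤κ ⟩
      edges G + K + κ x                                  ≡⟨ xy∙z≈x∙zy (edges G) K (κ x) ⟩
      edges G + (κ x + K)                                ∎
      where
      open ≤-Reasoning
      D = sum (map (deg G) xs)
      K = sum (map κ xs)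

    extension-of-ordering : ∀ {pre vs} → Unique pre → Unique vs → All (_∉ pre) vs →
      (∀ (i : Fin (length vs)) →
        countB (adj G (lookup vs i)) pre + countB (adj G (lookup vs i)) (take (toℕ i) vs) ≤ κ (lookup vs i)) →
      DegenerateExtension (mem pre) vs
    extension-of-ordering {vs = []} _ _ _ _ = []
    extension-of-ordering {pre} {x ∷ r} pre! (x∉r ∷ r!) (x∉pre ∷ r∉pre) back≤κ =
      extend (dec-false (any? (x ≟_) pre) x∉pre)
             (subst (_≤ κ x) (trans (+-identityʳ _) (sym (∑-mem≡countB (adj G x) pre!))) (back≤κ zero))
             (extension-of-ordering (¬Any⇒All¬ pre x∉pre ∷ pre!) r! r∉x∷pre back≤κ′)
      where
      r∉x∷pre : All (_∉ x ∷ pre) r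
      r∉x∷pre = All.zipWith (uncurry ∉-∷) (x∉r , r∉pre)
      back≤κ′ : ∀ (i : Fin (length r)) →
        countB (adj G (lookup r i)) (x ∷ pre) + countB (adj G (lookup r i)) (take (toℕ i) r) ≤ κ (lookup r i)
      back≤κ′ i = subst (_≤ κ y) (x∙yz≈yx∙z (countB (adj G y) pre) ⟦ adj G y x ⟧ (countB (adj G y) (take (toℕ i) r)))
                        (back≤κ (suc i))
        where y = lookup r i

    ordering⇒extension : ∀ {vs} → Unique vs → DegenerateOrdering G κ vs → DegenerateExtension ∅ vs
    ordering⇒extension vs! degenerate = extension-of-ordering [] vs! (All.universal (λ _ ()) _) degenerate

    -- The first vertex has no earlier neighbours, so it contributes its whole degree; this is where
    -- the −δ(G) in the bound comes from.
    rest+head≤edges : ∀ {b x r} → (∀ y → κ y + b ≤ deg G y) → DegenerateExtension ∅ (x ∷ r) →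
      b * length r + deg G x ≤ edges G
    rest+head≤edges {b} {x} {r} κ+b≤deg (extend _ _ ext) = +-cancelʳ-≤ K _ _ (begin
      b * length r + deg G x + K                ≡⟨ xy∙z≈y∙zx (b * length r) (deg G x) K ⟩
      deg G x + (K + b * length r)              ≤⟨ +-monoʳ-≤ (deg G x) (sum[f]+b*length≤sum[g] κ+b≤deg r) ⟩
      deg G x + sum (map (deg G) r)             ≡⟨ cong (_+ sum (map (deg G) r)) (sym (edgesTouching-singleton x)) ⟩
      edgesTouching (insert x ∅) + sum (map (deg G) r) ≤⟨ edgesTouching+∑deg≤edges+∑κ ext ⟩
      edges G + K                               ∎)
      where
      open ≤-Reasoning
      K = sum (map κ r)

    degenerate-size-bound : ∀ {b a δ₀ vs} → b ≤ a → (∀ y → δ₀ ≤ deg G y) → (∀ y → κ y + b ≤ deg G y) →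
      Unique vs → DegenerateOrdering G κ vs → b * length vs ≤ (edges G ∸ δ₀) + a
    degenerate-size-bound {b = b} {a} {δ₀} {[]} _ _ _ _ _ = subst (_≤ (edges G ∸ δ₀) + a) (sym (*-zeroʳ b)) z≤n
    degenerate-size-bound {b} {a} {δ₀} {x ∷ r} b≤a δ₀≤deg κ+b≤deg vs! degenerate = begin
      b * suc (length r)           ≡⟨ *-suc b (length r) ⟩
      b + b * length r             ≤⟨ +-mono-≤ b≤a (≤-trans rest≤ (∸-monoʳ-≤ (edges G) (δ₀≤deg x))) ⟩
      a + (edges G ∸ δ₀)           ≡⟨ +-comm a _ ⟩
      (edges G ∸ δ₀) + a           ∎
      where
      open ≤-Reasoning
      rest≤ : b * length r ≤ edges G ∸ deg G x
      rest≤ = m+n≤o⇒m≤o∸n (b * length r) (rest+head≤edges {b} κ+b≤deg (ordering⇒extension vs! degenerate))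

minℤ-≤ : ∀ {k} (f : Fin (suc k) → ℤ) i → minℤ f ℤ.≤ f i
minℤ-≤ {zero}  f zero    = ℤ.≤-refl
minℤ-≤ {suc k} f zero    = ℤ.i⊓j≤i _ _
minℤ-≤ {suc k} f (suc i) = ℤ.≤-trans (ℤ.i⊓j≤j _ _) (minℤ-≤ (λ j → f (suc j)) i)

maxℤ-≥ : ∀ {k} (f : Fin (suc k) → ℤ) i → f i ℤ.≤ maxℤ f
maxℤ-≥ {zero}  f zero    = ℤ.≤-refl
maxℤ-≥ {suc k} f zero    = ℤ.i≤i⊔j _ _
maxℤ-≥ {suc k} f (suc i) = ℤ.≤-trans (maxℤ-≥ (λ j → f (suc j)) i) (ℤ.i≤j⊔i _ _)

minℕ-≤ : ∀ {k} (f : Fin (suc k) → ℕ) i → minℕ f ≤ f i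
minℕ-≤ {zero}  f zero    = ≤-refl
minℕ-≤ {suc k} f zero    = m⊓n≤m _ _
minℕ-≤ {suc k} f (suc i) = ≤-trans (m⊓n≤n _ _) (minℕ-≤ (λ j → f (suc j)) i)

∣∣-mono-≤ : ∀ {i j : ℤ} → + 0 ℤ.≤ i → i ℤ.≤ j → ℤ.∣ i ∣ ≤ ℤ.∣ j ∣
∣∣-mono-≤ (+≤+ _) (+≤+ m≤n) = m≤n

≤+d-+k⇒k+∣∣≤d : ∀ {i : ℤ} {d k} → + 0 ℤ.≤ i → i ℤ.≤ + d - + k → k + ℤ.∣ i ∣ ≤ d
≤+d-+k⇒k+∣∣≤d {+ b} {d} {k} (+≤+ _) b≤d-k =
  ℤ.drop‿+≤+ (subst (+ (k + b) ℤ.≤_) k+[d-k]≡d (ℤ.+-monoʳ-≤ (+ k) b≤d-k))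
  where
  open +-*-Solver
  k+[d-k]≡d : + k ℤ.+ (+ d - + k) ≡ + d
  k+[d-k]≡d = solve 2 (λ k d → k :+ (d :- k) := d) refl (+ k) (+ d)

ℕ-bound⇒ℤ-bound : ∀ {β α : ℤ} {m δ₀ h} → δ₀ ≤ m → + 0 ℤ.≤ β → + 0 ℤ.≤ α →
  ℤ.∣ β ∣ * h ≤ (m ∸ δ₀) + ℤ.∣ α ∣ → β ℤ.* + h ℤ.≤ (+ m - + δ₀) ℤ.+ α
ℕ-bound⇒ℤ-bound {+ b} {+ a} {m} {δ₀} {h} δ₀≤m (+≤+ _) (+≤+ _) bh≤ =
  subst₂ ℤ._≤_ (ℤ.pos-* b h) (cong (ℤ._+ + a) (sym m-δ₀≡m∸δ₀)) (+≤+ bh≤)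
  where
  m-δ₀≡m∸δ₀ : + m - + δ₀ ≡ + (m ∸ δ₀)
  m-δ₀≡m∸δ₀ = trans (ℤ.[+m]-[+n]≡m⊖n m δ₀) (ℤ.⊖-≥ δ₀≤m)

theorem8 : ∀ {k} (G : Graph (suc k)) (κ : Fin (suc k) → ℕ) →
    (∀ v → 1 ≤ κ v) →
    + 0 ℤ.< minℤ (excess G κ) →
    (S : Subset (suc k)) → InducedDegenerate G κ S →
    minℤ (excess G κ) ℤ.* + ∣ S ∣ ℤ.≤ (+ edges G - + δ G) ℤ.+ maxℤ (excess G κ)
theorem8 G κ _ 0<β S (vs , (vs! , vs≈S) , degenerate) rewrite ∣∣≡length vs! vs≈S =
  ℕ-bound⇒ℤ-bound (≤-trans (minℕ-≤ (deg G) zero) (deg≤edges G zero)) 0≤β 0≤α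
    (degenerate-size-bound G κ (∣∣-mono-≤ 0≤β β≤α) (minℕ-≤ (deg G))
      (λ y → ≤+d-+k⇒k+∣∣≤d 0≤β (minℤ-≤ (excess G κ) y)) vs! degenerate)
  where
  0≤β : + 0 ℤ.≤ minℤ (excess G κ)
  0≤β = ℤ.<⇒≤ 0<β
  β≤α : minℤ (excess G κ) ℤ.≤ maxℤ (excess G κ)
  β≤α = ℤ.≤-trans (minℤ-≤ (excess G κ) zero) (maxℤ-≥ (excess G κ) zero)
  0≤α : + 0 ℤ.≤ maxℤ (excess G κ)
  0≤α = ℤ.≤-trans 0≤β β≤α
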